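{- Define polynomials $p_n(x,y,z)$ by \[ \sum_{n=0}^\infty p_n(x,y,z)q^n=\prod_{j=0}^\infty\left(1+xq^{2^j}\right)\left(1+yq^{2^j}+zq^{2\cdot 2^j}\right), \] and set $Q_n(x)=p_{2^{n+1}-2}(x,1,1)$ and $R_n(x)=p_{2^n-1}(x,1,1)$. Then for every integer $n\ge 1$, \[ x\,Q_{n-1}(x^2)+R_n(x^2)=(1+x+x^2)^n . \] Equivalently, the coefficients of $R_n(x)$ are the coefficients of the even powers of $x$ in $(1+x+x^2)^n$, and the coefficients of $Q_{n-1}(x)$ are those of the odd powers. -}

module Defs where

open import Data.Nat using (ℕ; zero; suc; _+_; _*_; _∸_; _^_; _≡ᵇ_; _%_)
open import Data.Bool using (if_then_else_)

Σ≤ : ℕ → (ℕ → ℕ) → ℕ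
Σ≤ zero    f = f 0
Σ≤ (suc n) f = Σ≤ n f + f (suc n)

-- Polynomials in one variable x with ℕ coefficients, represented by
-- their coefficient function (coefficient of x^k).

Poly₁ : Set
Poly₁ = ℕ → ℕ

_+₁_ : Poly₁ → Poly₁ → Poly₁
(f +₁ g) k = f k + g k

_*₁_ : Poly₁ → Poly₁ → Poly₁
(f *₁ g) k = Σ≤ k (λ i → f i * g (k ∸ i))

one₁ : Poly₁
one₁ zero    = 1
one₁ (suc _) = 0

X^ : ℕ → Poly₁
X^ a k = if k ≡ᵇ a then 1 else 0

_^₁_ : Poly₁ → ℕ → Poly₁
f ^₁ zero  = one₁
f ^₁ suc n = f *₁ (f ^₁ n)

mulX : Poly₁ → Poly₁
mulX f zero    = 0
mulX f (suc k) = f k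

subX² : Poly₁ → Poly₁
subX² f k = if (k % 2) ≡ᵇ 0 then f (Data.Nat._/_ k 2) else 0

-- Formal power series in q whose coefficients are polynomials in x,y,z
-- (ℕ coefficients).  A value  F a b c n  is the coefficient of
-- x^a y^b z^c q^n.

Ser : Set
Ser = ℕ → ℕ → ℕ → ℕ → ℕ

_+ₛ_ : Ser → Ser → Ser
(F +ₛ G) a b c n = F a b c n + G a b c n

_*ₛ_ : Ser → Ser → Ser
(F *ₛ G) a b c n =
  Σ≤ a λ i → Σ≤ b λ j → Σ≤ c λ l → Σ≤ n λ m →
    F i j l m * G (a ∸ i) (b ∸ j) (c ∸ l) (n ∸ m)

mono : ℕ → ℕ → ℕ → ℕ → Ser
mono a b c n a' b' c' n' =
  if (a' ≡ᵇ a) then (if (b' ≡ᵇ b) then (if (c' ≡ᵇ c) then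
    (if (n' ≡ᵇ n) then 1 else 0) else 0) else 0) else 0

oneₛ : Ser
oneₛ = mono 0 0 0 0

factor : ℕ → Ser
factor j = (oneₛ +ₛ mono 1 0 0 (2 ^ j))
        *ₛ (oneₛ +ₛ (mono 0 1 0 (2 ^ j) +ₛ mono 0 0 1 (2 * 2 ^ j)))

prodUpTo : ℕ → Ser
prodUpTo zero    = oneₛ
prodUpTo (suc N) = prodUpTo N *ₛ factor N

-- Factors with
-- 2^j > n contribute only 1 + O(q^{n+1}), so the coefficient of q^n is
-- already determined by the finite product over j < n+1 (2^{n+1} > n).
-- p n a b c = coefficient of x^a y^b z^c in p_n(x,y,z).

p : ℕ → ℕ → ℕ → ℕ → ℕ
p n a b c = prodUpTo (suc n) a b c n

-- Every y or z in the product comes with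
-- at least one power of q, so p_n has degree ≤ n in y and in z; the sum
-- over b,c ≤ n is therefore the full evaluation at y = z = 1.
p₁₁ : ℕ → Poly₁
p₁₁ n a = Σ≤ n λ b → Σ≤ n λ c → p n a b c

Q : ℕ → Poly₁
Q n = p₁₁ (2 ^ (suc n) ∸ 2)

R : ℕ → Poly₁
R n = p₁₁ (2 ^ n ∸ 1)

trinom : Poly₁
trinom = (X^ 0 +₁ X^ 1) +₁ X^ 2

-- Let F(q) = ∏ⱼ (1 + x q^(2^j)) (1 + y q^(2^j) + z q^(2·2^j)). Splitting off the factor j = 0 gives
-- F(q) = (1 + x q) (1 + y q + z q²) F(q²), so f_n = p_n(x,1,1) satisfies, with f₋₁ = 0,
--   f_(2k+1) = (1 + x) f_k + x f_(k-1)   and   f_(2k) = f_k + (1 + x) f_(k-1).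
-- For A = R_n = f_(2^n-1) and B = Q_(n-1) = f_(2^n-2) these say R_(n+1) = (1 + x) A + x B and
-- Q_n = A + (1 + x) B, and comparing even and odd coefficients then gives
-- R_(n+1)(x²) + x Q_n(x²) = (1 + x + x²) (A(x²) + x B(x²)), so induction on n proves the claim.
-- For the finite products the functional equation holds exactly, the coefficient of q^n is stable once
-- 2^N > n, and every y and z comes with a power of q, so summing over y- and z-degrees ≤ n is evaluation
-- at y = z = 1.

module Submission where

open import Data.Bool using (Bool; true; false; T; if_then_else_)
open import Data.List using (List; []; _∷_; map)
open import Data.List.Properties using (map-cong; map-cong-local; map-∘)
open import Data.List.Relation.Binary.Pointwise using (Pointwise-≡⇒≡; []; _∷_)
open import Data.List.Relation.Unary.All as All using (All; []; _∷_)
open import Data.Nat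
  using (ℕ; zero; suc; _+_; _*_; _∸_; _^_; _≡ᵇ_; _≤ᵇ_; _%_; _/_; _≤_; _<_; z≤n; s≤s; _≤′_; ≤′-refl; ≤′-step)
open import Data.Nat.DivMod using (m*n%n≡0; m*n/n≡m; [m+kn]%n≡m%n)
open import Data.Nat.ListAction using (sum)
open import Data.Nat.Properties
open import Data.Nat.Tactic.RingSolver using (solve-∀)
open import Algebra.Properties.CommutativeSemigroup +-commutativeSemigroup
  using (interchange; x∙yz≈y∙xz)
open import Data.Product using (_×_; _,_)
open import Function using (_∘_)
open import Relation.Binary.PropositionalEquality
open import Relation.Nullary using (yes; no; contradiction)
open import Relation.Nullary.Reflects using (ofʸ; ofⁿ)

open import Defs

open ≡-Reasoning

-- mono and subX² unfold definitionally into nested guards.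
guard : Bool → ℕ → ℕ
guard b x = if b then x else 0

guard-zero : ∀ b → guard b 0 ≡ 0
guard-zero true  = refl
guard-zero false = refl

guard-≡0 : ∀ b {x} → (T b → x ≡ 0) → guard b x ≡ 0
guard-≡0 true  x≡0 = x≡0 _
guard-≡0 false _   = refl

guard-comm : ∀ b c x → guard b (guard c x) ≡ guard c (guard b x)
guard-comm true  c     x = refl
guard-comm false true  x = refl
guard-comm false false x = refl

guard-≤ : ∀ {m n} x → m ≤ n → guard (m ≤ᵇ n) x ≡ x
guard-≤ {m} {n} x m≤n with m ≤ᵇ n | ≤ᵇ-reflects-≤ m n
... | true  | _        = refl
... | false | ofⁿ m≰n = contradiction m≤n m≰n

guard-≰ : ∀ {m n} x → n < m → guard (m ≤ᵇ n) x ≡ 0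
guard-≰ {m} {n} x n<m with m ≤ᵇ n | ≤ᵇ-reflects-≤ m n
... | true  | ofʸ m≤n = contradiction m≤n (<⇒≱ n<m)
... | false | _        = refl

≤ᵇ-suc : ∀ m n → (suc m ≤ᵇ suc n) ≡ (m ≤ᵇ n)
≤ᵇ-suc zero    n = refl
≤ᵇ-suc (suc m) n = refl

guard-≤ᵇ-suc : ∀ m n x → guard (suc m ≤ᵇ suc n) x ≡ guard (m ≤ᵇ n) x
guard-≤ᵇ-suc m n x = cong (λ b → guard b x) (≤ᵇ-suc m n)

guard-≤ᵇ-∸ : ∀ x y a z → guard (x ≤ᵇ a) (guard (y ≤ᵇ a ∸ x) z) ≡ guard (x + y ≤ᵇ a) z
guard-≤ᵇ-∸ zero    y a       z = refl
guard-≤ᵇ-∸ (suc x) y zero    z = refl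
guard-≤ᵇ-∸ (suc x) y (suc a) z = begin
  guard (suc x ≤ᵇ suc a) (guard (y ≤ᵇ a ∸ x) z)  ≡⟨ guard-≤ᵇ-suc x a _ ⟩
  guard (x ≤ᵇ a) (guard (y ≤ᵇ a ∸ x) z)          ≡⟨ guard-≤ᵇ-∸ x y a z ⟩
  guard (x + y ≤ᵇ a) z                           ≡⟨ guard-≤ᵇ-suc (x + y) a z ⟨
  guard (suc x + y ≤ᵇ suc a) z                   ∎

guard-≤ᵇ-∸≡ᵇ0 : ∀ x a z → guard (x ≤ᵇ a) (guard (a ∸ x ≡ᵇ 0) z) ≡ guard (a ≡ᵇ x) z
guard-≤ᵇ-∸≡ᵇ0 zero    a       z = refl
guard-≤ᵇ-∸≡ᵇ0 (suc x) zero    z = refl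
guard-≤ᵇ-∸≡ᵇ0 (suc x) (suc a) z = trans (guard-≤ᵇ-suc x a _) (guard-≤ᵇ-∸≡ᵇ0 x a z)

guard-interleave : ∀ p q r s p′ q′ r′ s′ x →
  guard p (guard q (guard r (guard s (guard p′ (guard q′ (guard r′ (guard s′ x)))))))
  ≡ guard p (guard p′ (guard q (guard q′ (guard r (guard r′ (guard s (guard s′ x)))))))
guard-interleave false q     r     s     p′ q′ r′ s′ x = refl
guard-interleave true  false r     s     p′ q′ r′ s′ x = sym (guard-zero p′)
guard-interleave true  true  false s     p′ q′ r′ s′ x = sym (guard-≡0 p′ λ _ → guard-zero q′)
guard-interleave true  true  true  false p′ q′ r′ s′ x =
  sym (guard-≡0 p′ λ _ → guard-≡0 q′ λ _ → guard-zero r′)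
guard-interleave true  true  true  true  p′ q′ r′ s′ x = refl

Σ≤-cong-≤ : ∀ n {f g : ℕ → ℕ} → (∀ i → i ≤ n → f i ≡ g i) → Σ≤ n f ≡ Σ≤ n g
Σ≤-cong-≤ zero    f≡g = f≡g 0 z≤n
Σ≤-cong-≤ (suc n) f≡g =
  cong₂ _+_ (Σ≤-cong-≤ n λ i i≤n → f≡g i (m≤n⇒m≤1+n i≤n)) (f≡g (suc n) ≤-refl)

Σ≤-cong : ∀ n {f g : ℕ → ℕ} → (∀ i → f i ≡ g i) → Σ≤ n f ≡ Σ≤ n g
Σ≤-cong n f≡g = Σ≤-cong-≤ n λ i _ → f≡g i

Σ≤-zero : ∀ n {f : ℕ → ℕ} → (∀ i → f i ≡ 0) → Σ≤ n f ≡ 0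
Σ≤-zero zero    f≡0 = f≡0 0
Σ≤-zero (suc n) f≡0 = cong₂ _+_ (Σ≤-zero n f≡0) (f≡0 (suc n))

Σ≤-distrib-+ : ∀ n (f g : ℕ → ℕ) → Σ≤ n (λ i → f i + g i) ≡ Σ≤ n f + Σ≤ n g
Σ≤-distrib-+ zero    f g = refl
Σ≤-distrib-+ (suc n) f g = begin
  Σ≤ n (λ i → f i + g i) + (f (suc n) + g (suc n))  ≡⟨ cong (_+ (f (suc n) + g (suc n))) (Σ≤-distrib-+ n f g) ⟩
  (Σ≤ n f + Σ≤ n g) + (f (suc n) + g (suc n))        ≡⟨ interchange (Σ≤ n f) (Σ≤ n g) _ _ ⟩
  (Σ≤ n f + f (suc n)) + (Σ≤ n g + g (suc n))        ∎

Σ≤-guard : ∀ n b (f : ℕ → ℕ) → Σ≤ n (λ i → guard b (f i)) ≡ guard b (Σ≤ n f)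
Σ≤-guard n true  f = refl
Σ≤-guard n false f = Σ≤-zero n λ _ → refl

Σ≤-head : ∀ n (f : ℕ → ℕ) → Σ≤ (suc n) f ≡ f 0 + Σ≤ n (λ i → f (suc i))
Σ≤-head zero    f = refl
Σ≤-head (suc n) f = trans (cong (_+ f (suc (suc n))) (Σ≤-head n f)) (+-assoc (f 0) _ _)

Σ≤-reverse : ∀ n (f : ℕ → ℕ) → Σ≤ n f ≡ Σ≤ n (λ i → f (n ∸ i))
Σ≤-reverse zero    f = refl
Σ≤-reverse (suc n) f = begin
  Σ≤ n f + f (suc n)                  ≡⟨ +-comm (Σ≤ n f) _ ⟩
  f (suc n) + Σ≤ n f                  ≡⟨ cong (f (suc n) +_) (Σ≤-reverse n f) ⟩
  f (suc n) + Σ≤ n (λ i → f (n ∸ i))  ≡⟨ Σ≤-head n (λ i → f (suc n ∸ i)) ⟨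
  Σ≤ (suc n) (λ i → f (suc n ∸ i))    ∎

Σ≤-truncate : ∀ {m M} (f : ℕ → ℕ) → m ≤ M → (∀ i → m < i → f i ≡ 0) → Σ≤ M f ≡ Σ≤ m f
Σ≤-truncate {m} f m≤M f≡0 = go (≤⇒≤′ m≤M)
  where
  go : ∀ {M} → m ≤′ M → Σ≤ M f ≡ Σ≤ m f
  go ≤′-refl              = refl
  go (≤′-step {M} m≤′M) =
    trans (cong₂ _+_ (go m≤′M) (f≡0 (suc M) (s≤s (≤′⇒≤ m≤′M)))) (+-identityʳ _)

Σ≤-indicator : ∀ a t (f : ℕ → ℕ) → Σ≤ a (λ i → guard (i ≡ᵇ t) (f i)) ≡ guard (t ≤ᵇ a) (f t)
Σ≤-indicator zero    zero    f = refl
Σ≤-indicator zero    (suc t) f = refl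
Σ≤-indicator (suc a) zero    f =
  trans (Σ≤-head a _) (trans (cong (f 0 +_) (Σ≤-zero a λ _ → refl)) (+-identityʳ (f 0)))
Σ≤-indicator (suc a) (suc t) f =
  trans (Σ≤-head a _) (trans (Σ≤-indicator a t (f ∘ suc)) (sym (guard-≤ᵇ-suc t a _)))

Σ≤-delta : ∀ a α (H : ℕ → ℕ) → Σ≤ a (λ i → guard (a ∸ i ≡ᵇ α) (H i)) ≡ guard (α ≤ᵇ a) (H (a ∸ α))
Σ≤-delta a α H = begin
  Σ≤ a (λ i → guard (a ∸ i ≡ᵇ α) (H i))
    ≡⟨ Σ≤-reverse a _ ⟩
  Σ≤ a (λ i → guard (a ∸ (a ∸ i) ≡ᵇ α) (H (a ∸ i)))
    ≡⟨ Σ≤-cong-≤ a (λ i i≤a → cong (λ j → guard (j ≡ᵇ α) (H (a ∸ i))) (m∸[m∸n]≡n i≤a)) ⟩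
  Σ≤ a (λ i → guard (i ≡ᵇ α) (H (a ∸ i)))
    ≡⟨ Σ≤-indicator a α (λ i → H (a ∸ i)) ⟩
  guard (α ≤ᵇ a) (H (a ∸ α))
  ∎

Σ≤-shift : ∀ k m (h : ℕ → ℕ) → Σ≤ (k + m) (λ i → guard (k ≤ᵇ i) (h (i ∸ k))) ≡ Σ≤ m h
Σ≤-shift zero    m h = refl
Σ≤-shift (suc k) m h =
  trans (Σ≤-head (k + m) _) (trans (Σ≤-cong (k + m) λ i → guard-≤ᵇ-suc k i _) (Σ≤-shift k m h))

Σ≤-shift-truncate : ∀ {k m n} (h : ℕ → ℕ) → k ≤ n → m ≤ n ∸ k → (∀ i → m < i → h i ≡ 0) →
  Σ≤ n (λ i → guard (k ≤ᵇ i) (h (i ∸ k))) ≡ Σ≤ m h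
Σ≤-shift-truncate {k} {m} {n} h k≤n m≤n∸k h≡0 = begin
  Σ≤ n _              ≡⟨ cong (λ N → Σ≤ N _) (m+[n∸m]≡n k≤n) ⟨
  Σ≤ (k + (n ∸ k)) _  ≡⟨ Σ≤-shift k (n ∸ k) h ⟩
  Σ≤ (n ∸ k) h        ≡⟨ Σ≤-truncate h m≤n∸k h≡0 ⟩
  Σ≤ m h              ∎

module _ {A : Set} where

  sum-map-cong : ∀ {f g : A → ℕ} → (∀ x → f x ≡ g x) → ∀ L → sum (map f L) ≡ sum (map g L)
  sum-map-cong f≡g L = cong sum (map-cong f≡g L)

  sum-map-congᴬ : ∀ {f g : A → ℕ} {L} → All (λ x → f x ≡ g x) L → sum (map f L) ≡ sum (map g L)
  sum-map-congᴬ f≡g = cong sum (map-cong-local f≡g)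

  sum-map-zero : ∀ {f : A → ℕ} {L} → All (λ x → f x ≡ 0) L → sum (map f L) ≡ 0
  sum-map-zero []           = refl
  sum-map-zero (fx≡0 ∷ f≡0) = cong₂ _+_ fx≡0 (sum-map-zero f≡0)

  sum-map-+ : ∀ (f g : A → ℕ) L → sum (map (λ x → f x + g x) L) ≡ sum (map f L) + sum (map g L)
  sum-map-+ f g []      = refl
  sum-map-+ f g (x ∷ L) = trans (cong (f x + g x +_) (sum-map-+ f g L)) (interchange (f x) (g x) _ _)

  guard-sum : ∀ b (f : A → ℕ) L → guard b (sum (map f L)) ≡ sum (map (λ x → guard b (f x)) L)
  guard-sum true  f L = refl
  guard-sum false f L = sym (sum-map-zero (All.universal (λ _ → refl) L))

  Σ≤-sum : ∀ n (f : ℕ → A → ℕ) L → Σ≤ n (λ i → sum (map (f i) L)) ≡ sum (map (λ x → Σ≤ n (λ i → f i x)) L)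
  Σ≤-sum zero    f L = refl
  Σ≤-sum (suc n) f L =
    trans (cong (_+ sum (map (f (suc n)) L)) (Σ≤-sum n f L)) (sym (sum-map-+ _ (f (suc n)) L))

sum-swap : ∀ {A B : Set} (f : A → B → ℕ) L M →
  sum (map (λ x → sum (map (f x) M)) L) ≡ sum (map (λ y → sum (map (λ x → f x y) L)) M)
sum-swap f []      M = sym (sum-map-zero (All.universal (λ _ → refl) M))
sum-swap f (x ∷ L) M =
  trans (cong (sum (map (f x) M) +_) (sum-swap f L M)) (sym (sum-map-+ (f x) _ M))

-- Multiplication by monomials

infix 4 _≐_
_≐_ : Ser → Ser → Set
F ≐ G = ∀ a b c n → F a b c n ≡ G a b c n

Exponent : Set
Exponent = ℕ × ℕ × ℕ × ℕ

_⊕_ : Exponent → Exponent → Exponent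
(α , β , γ , ν) ⊕ (α′ , β′ , γ′ , ν′) = (α + α′ , β + β′ , γ + γ′ , ν + ν′)

⊕-comm : ∀ e e′ → e ⊕ e′ ≡ e′ ⊕ e
⊕-comm (α , β , γ , ν) (α′ , β′ , γ′ , ν′) =
  cong₂ _,_ (+-comm α α′) (cong₂ _,_ (+-comm β β′) (cong₂ _,_ (+-comm γ γ′) (+-comm ν ν′)))

monomial : Exponent → Ser
monomial (α , β , γ , ν) = mono α β γ ν

shift : Exponent → Ser → Ser
shift (α , β , γ , ν) F a b c n =
  guard (α ≤ᵇ a) (guard (β ≤ᵇ b) (guard (γ ≤ᵇ c) (guard (ν ≤ᵇ n) (F (a ∸ α) (b ∸ β) (c ∸ γ) (n ∸ ν)))))

shift-cong : ∀ e {F G} → F ≐ G → shift e F ≐ shift e G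
shift-cong (α , β , γ , ν) F≐G a b c n =
  cong (λ x → guard (α ≤ᵇ a) (guard (β ≤ᵇ b) (guard (γ ≤ᵇ c) (guard (ν ≤ᵇ n) x))))
       (F≐G (a ∸ α) (b ∸ β) (c ∸ γ) (n ∸ ν))

shift-shift : ∀ e e′ F → shift e (shift e′ F) ≐ shift (e ⊕ e′) F
shift-shift (α , β , γ , ν) (α′ , β′ , γ′ , ν′) F a b c n =
  trans (guard-interleave (α ≤ᵇ a) (β ≤ᵇ b) (γ ≤ᵇ c) (ν ≤ᵇ n)
                          (α′ ≤ᵇ a ∸ α) (β′ ≤ᵇ b ∸ β) (γ′ ≤ᵇ c ∸ γ) (ν′ ≤ᵇ n ∸ ν) _)
        (merge α α′ a (merge β β′ b (merge γ γ′ c (merge ν ν′ n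
          (trans (cong₂ (λ x y → F x y (c ∸ γ ∸ γ′) (n ∸ ν ∸ ν′)) (∸-+-assoc a α α′) (∸-+-assoc b β β′))
                 (cong₂ (F (a ∸ (α + α′)) (b ∸ (β + β′))) (∸-+-assoc c γ γ′) (∸-+-assoc n ν ν′)))))))
  where
  merge : ∀ x y m {z z′} → z ≡ z′ → guard (x ≤ᵇ m) (guard (y ≤ᵇ m ∸ x) z) ≡ guard (x + y ≤ᵇ m) z′
  merge x y m z≡z′ = trans (guard-≤ᵇ-∸ x y m _) (cong (guard (x + y ≤ᵇ m)) z≡z′)

monomial≐shift-oneₛ : ∀ e → monomial e ≐ shift e oneₛ
monomial≐shift-oneₛ (α , β , γ , ν) a b c n =
  sym (trans (guard-interleave (α ≤ᵇ a) (β ≤ᵇ b) (γ ≤ᵇ c) (ν ≤ᵇ n)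
                               (a ∸ α ≡ᵇ 0) (b ∸ β ≡ᵇ 0) (c ∸ γ ≡ᵇ 0) (n ∸ ν ≡ᵇ 0) 1)
             (merge α a (merge β b (merge γ c (guard-≤ᵇ-∸≡ᵇ0 ν n 1)))))
  where
  merge : ∀ x m {z z′} → z ≡ z′ → guard (x ≤ᵇ m) (guard (m ∸ x ≡ᵇ 0) z) ≡ guard (m ≡ᵇ x) z′
  merge x m z≡z′ = trans (guard-≤ᵇ-∸≡ᵇ0 x m _) (cong (guard (m ≡ᵇ x)) z≡z′)

*-guard⁴ : ∀ p q r s x → x * guard p (guard q (guard r (guard s 1))) ≡ guard p (guard q (guard r (guard s x)))
*-guard⁴ true  true  true  true  x = *-identityʳ x
*-guard⁴ true  true  true  false x = *-zeroʳ x
*-guard⁴ true  true  false s     x = *-zeroʳ x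
*-guard⁴ true  false r     s     x = *-zeroʳ x
*-guard⁴ false q     r     s     x = *-zeroʳ x

*ₛ-monomial : ∀ F e → F *ₛ monomial e ≐ shift e F
*ₛ-monomial F (α , β , γ , ν) a b c n = begin
    (Σ≤ a λ i → Σ≤ b λ j → Σ≤ c λ l → Σ≤ n λ m →
      F i j l m * mono α β γ ν (a ∸ i) (b ∸ j) (c ∸ l) (n ∸ m))
  ≡⟨ (Σ≤-cong a λ i → Σ≤-cong b λ j → Σ≤-cong c λ l → Σ≤-cong n λ m →
       *-guard⁴ (a ∸ i ≡ᵇ α) (b ∸ j ≡ᵇ β) (c ∸ l ≡ᵇ γ) (n ∸ m ≡ᵇ ν) (F i j l m)) ⟩
    (Σ≤ a λ i → Σ≤ b λ j → Σ≤ c λ l → Σ≤ n λ m →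
      guard (a ∸ i ≡ᵇ α) (guard (b ∸ j ≡ᵇ β) (guard (c ∸ l ≡ᵇ γ) (guard (n ∸ m ≡ᵇ ν) (F i j l m)))))
  ≡⟨ (Σ≤-cong a λ i → Σ≤-cong b λ j → Σ≤-cong c λ l →
       pull n (a ∸ i ≡ᵇ α) (pull n (b ∸ j ≡ᵇ β) (pull n (c ∸ l ≡ᵇ γ) (Σ≤-delta n ν (F i j l))))) ⟩
    (Σ≤ a λ i → Σ≤ b λ j → Σ≤ c λ l →
      guard (a ∸ i ≡ᵇ α) (guard (b ∸ j ≡ᵇ β) (guard (c ∸ l ≡ᵇ γ) (guard (ν ≤ᵇ n) (F i j l (n ∸ ν))))))
  ≡⟨ (Σ≤-cong a λ i → Σ≤-cong b λ j →
       pull c (a ∸ i ≡ᵇ α) (pull c (b ∸ j ≡ᵇ β) (Σ≤-delta c γ λ l → guard (ν ≤ᵇ n) (F i j l (n ∸ ν))))) ⟩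
    (Σ≤ a λ i → Σ≤ b λ j →
      guard (a ∸ i ≡ᵇ α) (guard (b ∸ j ≡ᵇ β) (guard (γ ≤ᵇ c) (guard (ν ≤ᵇ n) (F i j (c ∸ γ) (n ∸ ν))))))
  ≡⟨ (Σ≤-cong a λ i →
       pull b (a ∸ i ≡ᵇ α) (Σ≤-delta b β λ j → guard (γ ≤ᵇ c) (guard (ν ≤ᵇ n) (F i j (c ∸ γ) (n ∸ ν))))) ⟩
    (Σ≤ a λ i →
      guard (a ∸ i ≡ᵇ α) (guard (β ≤ᵇ b) (guard (γ ≤ᵇ c) (guard (ν ≤ᵇ n) (F i (b ∸ β) (c ∸ γ) (n ∸ ν))))))
  ≡⟨ Σ≤-delta a α (λ i → guard (β ≤ᵇ b) (guard (γ ≤ᵇ c) (guard (ν ≤ᵇ n) (F i (b ∸ β) (c ∸ γ) (n ∸ ν))))) ⟩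
    shift (α , β , γ , ν) F a b c n
  ∎
  where
  pull : ∀ N p {f y} → Σ≤ N f ≡ y → Σ≤ N (λ k → guard p (f k)) ≡ guard p y
  pull N p {f} Σf≡y = trans (Σ≤-guard N p f) (cong (guard p) Σf≡y)

monomial-*ₛ : ∀ e e′ → monomial e *ₛ monomial e′ ≐ monomial (e′ ⊕ e)
monomial-*ₛ e e′ a b c n = begin
  (monomial e *ₛ monomial e′) a b c n  ≡⟨ *ₛ-monomial (monomial e) e′ a b c n ⟩
  shift e′ (monomial e) a b c n        ≡⟨ shift-cong e′ (monomial≐shift-oneₛ e) a b c n ⟩
  shift e′ (shift e oneₛ) a b c n      ≡⟨ shift-shift e′ e oneₛ a b c n ⟩
  shift (e′ ⊕ e) oneₛ a b c n          ≡⟨ monomial≐shift-oneₛ (e′ ⊕ e) a b c n ⟨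
  monomial (e′ ⊕ e) a b c n            ∎

oneₛ-*ₛ : ∀ e → oneₛ *ₛ monomial e ≐ monomial e
oneₛ-*ₛ e a b c n = trans (*ₛ-monomial oneₛ e a b c n) (sym (monomial≐shift-oneₛ e a b c n))

Σ⁴-distrib-+ : ∀ a b c n (f g : ℕ → ℕ → ℕ → ℕ → ℕ) →
  (Σ≤ a λ i → Σ≤ b λ j → Σ≤ c λ l → Σ≤ n λ m → f i j l m + g i j l m)
  ≡ (Σ≤ a λ i → Σ≤ b λ j → Σ≤ c λ l → Σ≤ n λ m → f i j l m)
    + (Σ≤ a λ i → Σ≤ b λ j → Σ≤ c λ l → Σ≤ n λ m → g i j l m)
Σ⁴-distrib-+ a b c n f g =
  trans (Σ≤-cong a λ i → trans (Σ≤-cong b λ j → trans (Σ≤-cong c λ l →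
           Σ≤-distrib-+ n (f i j l) (g i j l)) (Σ≤-distrib-+ c _ _)) (Σ≤-distrib-+ b _ _))
        (Σ≤-distrib-+ a _ _)

*ₛ-congʳ : ∀ F {G G′} → G ≐ G′ → F *ₛ G ≐ F *ₛ G′
*ₛ-congʳ F G≐G′ a b c n = Σ≤-cong a λ i → Σ≤-cong b λ j → Σ≤-cong c λ l → Σ≤-cong n λ m →
  cong (F i j l m *_) (G≐G′ (a ∸ i) (b ∸ j) (c ∸ l) (n ∸ m))

*ₛ-distribˡ-+ₛ : ∀ F G H → F *ₛ (G +ₛ H) ≐ (F *ₛ G) +ₛ (F *ₛ H)
*ₛ-distribˡ-+ₛ F G H a b c n =
  trans (Σ≤-cong a λ i → Σ≤-cong b λ j → Σ≤-cong c λ l → Σ≤-cong n λ m → *-distribˡ-+ (F i j l m) _ _)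
        (Σ⁴-distrib-+ a b c n _ _)

*ₛ-distribʳ-+ₛ : ∀ F G H → (F +ₛ G) *ₛ H ≐ (F *ₛ H) +ₛ (G *ₛ H)
*ₛ-distribʳ-+ₛ F G H a b c n =
  trans (Σ≤-cong a λ i → Σ≤-cong b λ j → Σ≤-cong c λ l → Σ≤-cong n λ m → *-distribʳ-+ _ (F i j l m) _)
        (Σ⁴-distrib-+ a b c n _ _)

*ₛ-zeroʳ : ∀ F → F *ₛ (λ _ _ _ _ → 0) ≐ (λ _ _ _ _ → 0)
*ₛ-zeroʳ F a b c n =
  Σ≤-zero a λ i → Σ≤-zero b λ j → Σ≤-zero c λ l → Σ≤-zero n λ m → *-zeroʳ (F i j l m)

*ₛ-sum : ∀ {A : Set} F (G : A → Ser) L →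
  F *ₛ (λ a b c n → sum (map (λ x → G x a b c n) L)) ≐ (λ a b c n → sum (map (λ x → (F *ₛ G x) a b c n) L))
*ₛ-sum F G []      = *ₛ-zeroʳ F
*ₛ-sum F G (x ∷ L) a b c n =
  trans (*ₛ-distribˡ-+ₛ F (G x) (λ a b c n → sum (map (λ x → G x a b c n) L)) a b c n)
        (cong ((F *ₛ G x) a b c n +_) (*ₛ-sum F G L a b c n))

-- The monomials of (1 + x q^s) (1 + y q^s + z q^(2s)), in the order in which the product expands.
nonUnitExponents : ℕ → List Exponent
nonUnitExponents s =
  (0 , 1 , 0 , s) ∷ (0 , 0 , 1 , 2 * s) ∷ (1 , 0 , 0 , s) ∷ (1 , 1 , 0 , s + s) ∷ (1 , 0 , 1 , 2 * s + s) ∷ []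

factorExponents : ℕ → List Exponent
factorExponents s = (0 , 0 , 0 , 0) ∷ nonUnitExponents s

factor-expand : ∀ j → factor j ≐ λ a b c n → sum (map (λ e → monomial e a b c n) (factorExponents (2 ^ j)))
factor-expand j a b c n = begin
  ((oneₛ +ₛ X) *ₛ YZ) a b c n
    ≡⟨ *ₛ-distribʳ-+ₛ oneₛ X YZ a b c n ⟩
  (oneₛ *ₛ YZ) a b c n + (X *ₛ YZ) a b c n
    ≡⟨ cong₂ _+_ (expand oneₛ) (expand X) ⟩
  ((oneₛ *ₛ oneₛ) a b c n + ((oneₛ *ₛ Y) a b c n + (oneₛ *ₛ Z) a b c n))
    + ((X *ₛ oneₛ) a b c n + ((X *ₛ Y) a b c n + (X *ₛ Z) a b c n))
    ≡⟨ cong₂ _+_ (cong₂ _+_ (oneₛ-*ₛ _ a b c n) (cong₂ _+_ (oneₛ-*ₛ _ a b c n) (oneₛ-*ₛ _ a b c n)))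
                 (cong₂ _+_ (monomial-*ₛ x _ a b c n)
                            (cong₂ _+_ (monomial-*ₛ x _ a b c n) (monomial-*ₛ x _ a b c n))) ⟩
  (m₀ + (m₁ + m₂)) + (m₃ + (m₄ + m₅))
    ≡⟨ reassociate m₀ m₁ m₂ m₃ m₄ m₅ ⟩
  m₀ + (m₁ + (m₂ + (m₃ + (m₄ + (m₅ + 0)))))
  ∎
  where
  s = 2 ^ j
  x : Exponent
  x = (1 , 0 , 0 , s)
  X Y Z YZ : Ser
  X = mono 1 0 0 s
  Y = mono 0 1 0 s
  Z = mono 0 0 1 (2 * s)
  YZ = oneₛ +ₛ (Y +ₛ Z)
  expand : ∀ F → (F *ₛ YZ) a b c n ≡ (F *ₛ oneₛ) a b c n + ((F *ₛ Y) a b c n + (F *ₛ Z) a b c n)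
  expand F = trans (*ₛ-distribˡ-+ₛ F oneₛ (Y +ₛ Z) a b c n)
                   (cong ((F *ₛ oneₛ) a b c n +_) (*ₛ-distribˡ-+ₛ F Y Z a b c n))
  m₀ = mono 0 0 0 0 a b c n
  m₁ = mono 0 1 0 s a b c n
  m₂ = mono 0 0 1 (2 * s) a b c n
  m₃ = mono 1 0 0 s a b c n
  m₄ = mono 1 1 0 (s + s) a b c n
  m₅ = mono 1 0 1 (2 * s + s) a b c n
  reassociate : ∀ p q r t u v → (p + (q + r)) + (t + (u + v)) ≡ p + (q + (r + (t + (u + (v + 0)))))
  reassociate = solve-∀

timesFactor : ℕ → Ser → Ser
timesFactor s F a b c n = sum (map (λ e → shift e F a b c n) (factorExponents s))

timesFactor-cong : ∀ s {F G} → F ≐ G → timesFactor s F ≐ timesFactor s G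
timesFactor-cong s F≐G a b c n = sum-map-cong (λ e → shift-cong e F≐G a b c n) (factorExponents s)

prodUpTo-suc : ∀ N → prodUpTo (suc N) ≐ timesFactor (2 ^ N) (prodUpTo N)
prodUpTo-suc N a b c n = begin
  (P *ₛ factor N) a b c n
    ≡⟨ *ₛ-congʳ P (factor-expand N) a b c n ⟩
  (P *ₛ (λ a b c n → sum (map (λ e → monomial e a b c n) E))) a b c n
    ≡⟨ *ₛ-sum P monomial E a b c n ⟩
  sum (map (λ e → (P *ₛ monomial e) a b c n) E)
    ≡⟨ sum-map-cong (λ e → *ₛ-monomial P e a b c n) E ⟩
  timesFactor (2 ^ N) P a b c n
  ∎
  where
  P = prodUpTo N
  E = factorExponents (2 ^ N)

shift-timesFactor : ∀ e s F a b c n →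
  shift e (timesFactor s F) a b c n ≡ sum (map (λ e′ → shift (e ⊕ e′) F a b c n) (factorExponents s))
shift-timesFactor (α , β , γ , ν) s F a b c n = begin
  guard (α ≤ᵇ a) (guard (β ≤ᵇ b) (guard (γ ≤ᵇ c) (guard (ν ≤ᵇ n) (sum (map f E)))))
    ≡⟨ cong (guard (α ≤ᵇ a)) (cong (guard (β ≤ᵇ b)) (cong (guard (γ ≤ᵇ c)) (guard-sum (ν ≤ᵇ n) f E))) ⟩
  guard (α ≤ᵇ a) (guard (β ≤ᵇ b) (guard (γ ≤ᵇ c) (sum (map (guard (ν ≤ᵇ n) ∘ f) E))))
    ≡⟨ cong (guard (α ≤ᵇ a)) (cong (guard (β ≤ᵇ b)) (guard-sum (γ ≤ᵇ c) (guard (ν ≤ᵇ n) ∘ f) E)) ⟩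
  guard (α ≤ᵇ a) (guard (β ≤ᵇ b) (sum (map (guard (γ ≤ᵇ c) ∘ guard (ν ≤ᵇ n) ∘ f) E)))
    ≡⟨ cong (guard (α ≤ᵇ a)) (guard-sum (β ≤ᵇ b) (guard (γ ≤ᵇ c) ∘ guard (ν ≤ᵇ n) ∘ f) E) ⟩
  guard (α ≤ᵇ a) (sum (map (guard (β ≤ᵇ b) ∘ guard (γ ≤ᵇ c) ∘ guard (ν ≤ᵇ n) ∘ f) E))
    ≡⟨ guard-sum (α ≤ᵇ a) (guard (β ≤ᵇ b) ∘ guard (γ ≤ᵇ c) ∘ guard (ν ≤ᵇ n) ∘ f) E ⟩
  sum (map (λ e′ → shift (α , β , γ , ν) (shift e′ F) a b c n) E)
    ≡⟨ sum-map-cong (λ e′ → shift-shift (α , β , γ , ν) e′ F a b c n) E ⟩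
  sum (map (λ e′ → shift ((α , β , γ , ν) ⊕ e′) F a b c n) E)
  ∎
  where
  E = factorExponents s
  f = λ e′ → shift e′ F (a ∸ α) (b ∸ β) (c ∸ γ) (n ∸ ν)

timesFactor-comm : ∀ s t F → timesFactor s (timesFactor t F) ≐ timesFactor t (timesFactor s F)
timesFactor-comm s t F a b c n = begin
  sum (map (λ e → shift e (timesFactor t F) a b c n) (E s))
    ≡⟨ sum-map-cong (λ e → shift-timesFactor e t F a b c n) (E s) ⟩
  sum (map (λ e → sum (map (λ e′ → shift (e ⊕ e′) F a b c n) (E t))) (E s))
    ≡⟨ sum-swap (λ e e′ → shift (e ⊕ e′) F a b c n) (E s) (E t) ⟩
  sum (map (λ e′ → sum (map (λ e → shift (e ⊕ e′) F a b c n) (E s))) (E t))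
    ≡⟨ sum-map-cong (λ e′ → sum-map-cong (λ e → cong (λ e″ → shift e″ F a b c n) (⊕-comm e e′)) (E s)) (E t) ⟩
  sum (map (λ e′ → sum (map (λ e → shift (e′ ⊕ e) F a b c n) (E s))) (E t))
    ≡⟨ sum-map-cong (λ e′ → shift-timesFactor e′ s F a b c n) (E t) ⟨
  sum (map (λ e′ → shift e′ (timesFactor s F) a b c n) (E t))
  ∎
  where E = factorExponents

-- The substitution q ↦ q²

data Parity : ℕ → Set where
  even : ∀ t → Parity (t * 2)
  odd  : ∀ t → Parity (suc (t * 2))

parity : ∀ n → Parity n
parity zero    = even 0
parity (suc n) with parity n
... | even t = odd t
... | odd  t = even (suc t)

subX²-even : ∀ f t → subX² f (t * 2) ≡ f t
subX²-even f t = trans (cong (λ r → guard (r ≡ᵇ 0) (f (t * 2 / 2))) (m*n%n≡0 t 2)) (cong f (m*n/n≡m t 2))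

subX²-odd : ∀ f t → subX² f (suc (t * 2)) ≡ 0
subX²-odd f t = cong (λ r → guard (r ≡ᵇ 0) (f (suc (t * 2) / 2))) ([m+kn]%n≡m%n 1 t 2)

subX²-guard : ∀ B h n → subX² (λ m → guard B (h m)) n ≡ guard B (subX² h n)
subX²-guard B h n = guard-comm (n % 2 ≡ᵇ 0) B (h (n / 2))

shiftq : ℕ → (ℕ → ℕ) → ℕ → ℕ
shiftq ν h m = guard (ν ≤ᵇ m) (h (m ∸ ν))

subX²-shiftq : ∀ ν h n → subX² (shiftq ν h) n ≡ shiftq (ν * 2) (subX² h) n
subX²-shiftq ν h n with parity n
... | even t with ν ≤? t
...   | yes ν≤t = begin
  subX² (shiftq ν h) (t * 2)                        ≡⟨ subX²-even (shiftq ν h) t ⟩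
  guard (ν ≤ᵇ t) (h (t ∸ ν))                        ≡⟨ guard-≤ (h (t ∸ ν)) ν≤t ⟩
  h (t ∸ ν)                                         ≡⟨ subX²-even h (t ∸ ν) ⟨
  subX² h ((t ∸ ν) * 2)                             ≡⟨ cong (subX² h) (*-distribʳ-∸ 2 t ν) ⟩
  subX² h (t * 2 ∸ ν * 2)                           ≡⟨ guard-≤ _ (*-monoˡ-≤ 2 ν≤t) ⟨
  guard (ν * 2 ≤ᵇ t * 2) (subX² h (t * 2 ∸ ν * 2))  ∎
...   | no ν≰t = trans (subX²-even (shiftq ν h) t)
                       (trans (guard-≰ (h (t ∸ ν)) t<ν) (sym (guard-≰ _ (*-monoˡ-< 2 t<ν))))
  where t<ν = ≰⇒> ν≰t
subX²-shiftq ν h n | odd t with ν ≤? t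
...   | yes ν≤t = begin
  subX² (shiftq ν h) (suc (t * 2))                              ≡⟨ subX²-odd (shiftq ν h) t ⟩
  0                                                             ≡⟨ subX²-odd h (t ∸ ν) ⟨
  subX² h (suc ((t ∸ ν) * 2))                                   ≡⟨ cong (subX² h ∘ suc) (*-distribʳ-∸ 2 t ν) ⟩
  subX² h (suc (t * 2 ∸ ν * 2))                                 ≡⟨ cong (subX² h) (+-∸-assoc 1 ν*2≤t*2) ⟨
  subX² h (suc (t * 2) ∸ ν * 2)                                 ≡⟨ guard-≤ _ (m≤n⇒m≤1+n ν*2≤t*2) ⟨
  guard (ν * 2 ≤ᵇ suc (t * 2)) (subX² h (suc (t * 2) ∸ ν * 2))  ∎
  where ν*2≤t*2 = *-monoˡ-≤ 2 ν≤t
...   | no ν≰t = trans (subX²-odd (shiftq ν h) t) (sym (guard-≰ _ (*-monoˡ-≤ 2 (≰⇒> ν≰t))))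

substQ² : Ser → Ser
substQ² F a b c = subX² (F a b c)

substQ²-cong : ∀ {F G} → F ≐ G → substQ² F ≐ substQ² G
substQ²-cong F≐G a b c n = cong (guard (n % 2 ≡ᵇ 0)) (F≐G a b c (n / 2))

double : Exponent → Exponent
double (α , β , γ , ν) = (α , β , γ , ν * 2)

substQ²-shift : ∀ e F → substQ² (shift e F) ≐ shift (double e) (substQ² F)
substQ²-shift (α , β , γ , ν) F a b c n =
  trans (subX²-guard (α ≤ᵇ a) (λ m → guard (β ≤ᵇ b) (guard (γ ≤ᵇ c) (h m))) n) (cong (guard (α ≤ᵇ a))
  (trans (subX²-guard (β ≤ᵇ b) (λ m → guard (γ ≤ᵇ c) (h m)) n) (cong (guard (β ≤ᵇ b))
  (trans (subX²-guard (γ ≤ᵇ c) h n) (cong (guard (γ ≤ᵇ c))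
  (subX²-shiftq ν (F (a ∸ α) (b ∸ β) (c ∸ γ)) n))))))
  where h = shiftq ν (F (a ∸ α) (b ∸ β) (c ∸ γ))

factorExponents-double : ∀ s → map double (factorExponents s) ≡ factorExponents (2 * s)
factorExponents-double s
  rewrite *-distribʳ-+ 2 s s | *-distribʳ-+ 2 (2 * s) s | *-comm s 2 | *-comm (2 * s) 2 = refl

substQ²-timesFactor : ∀ s F → substQ² (timesFactor s F) ≐ timesFactor (2 * s) (substQ² F)
substQ²-timesFactor s F a b c n = begin
  subX² (λ m → sum (map (λ e → shift e F a b c m) E)) n
    ≡⟨ guard-sum (n % 2 ≡ᵇ 0) (λ e → shift e F a b c (n / 2)) E ⟩
  sum (map (λ e → substQ² (shift e F) a b c n) E)
    ≡⟨ sum-map-cong (λ e → substQ²-shift e F a b c n) E ⟩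
  sum (map (g ∘ double) E)
    ≡⟨ cong sum (map-∘ {g = g} {f = double} E) ⟩
  sum (map g (map double E))
    ≡⟨ cong (sum ∘ map g) (factorExponents-double s) ⟩
  timesFactor (2 * s) (substQ² F) a b c n
  ∎
  where
  E = factorExponents s
  g = λ e → shift e (substQ² F) a b c n

oneₛ≐substQ²-oneₛ : oneₛ ≐ substQ² oneₛ
oneₛ≐substQ²-oneₛ a b c n with parity n
... | even zero    = refl
... | even (suc t) = sym (subX²-even (oneₛ a b c) (suc t))
... | odd t        =
  trans (guard-≡0 (a ≡ᵇ 0) λ _ → guard-≡0 (b ≡ᵇ 0) λ _ → guard-zero (c ≡ᵇ 0)) (sym (subX²-odd (oneₛ a b c) t))

prodUpTo-functional : ∀ N → prodUpTo (suc N) ≐ timesFactor 1 (substQ² (prodUpTo N))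
prodUpTo-functional zero a b c n =
  trans (prodUpTo-suc 0 a b c n) (timesFactor-cong 1 oneₛ≐substQ²-oneₛ a b c n)
prodUpTo-functional (suc N) a b c n = begin
  prodUpTo (suc (suc N)) a b c n
    ≡⟨ prodUpTo-suc (suc N) a b c n ⟩
  timesFactor (2 ^ suc N) (prodUpTo (suc N)) a b c n
    ≡⟨ timesFactor-cong (2 ^ suc N) (prodUpTo-functional N) a b c n ⟩
  timesFactor (2 ^ suc N) (timesFactor 1 (substQ² (prodUpTo N))) a b c n
    ≡⟨ timesFactor-comm (2 ^ suc N) 1 (substQ² (prodUpTo N)) a b c n ⟩
  timesFactor 1 (timesFactor (2 ^ suc N) (substQ² (prodUpTo N))) a b c n
    ≡⟨ timesFactor-cong 1 (substQ²-timesFactor (2 ^ N) (prodUpTo N)) a b c n ⟨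
  timesFactor 1 (substQ² (timesFactor (2 ^ N) (prodUpTo N))) a b c n
    ≡⟨ timesFactor-cong 1 (substQ²-cong (prodUpTo-suc N)) a b c n ⟨
  timesFactor 1 (substQ² (prodUpTo (suc N))) a b c n
  ∎

-- Degree bounds and stabilisation

YZ≤Q : Ser → Set
YZ≤Q F = ∀ a b c n → n < b + c → F a b c n ≡ 0

nonUnitExponents-bounds : ∀ s → All (λ { (_ , β , γ , ν) → β + γ ≤ 1 × s ≤ ν }) (nonUnitExponents s)
nonUnitExponents-bounds s =
  (≤-refl , ≤-refl) ∷ (≤-refl , m≤m+n s _) ∷ (z≤n , ≤-refl) ∷ (≤-refl , m≤m+n s s) ∷
  (≤-refl , ≤-trans (m≤m+n s _) (m≤m+n (2 * s) s)) ∷ []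

+-∸-+ : ∀ {b c β γ} → β ≤ b → γ ≤ c → (b + c) ∸ (β + γ) ≡ (b ∸ β) + (c ∸ γ)
+-∸-+ {b} {c} {β} {γ} β≤b γ≤c =
  trans (sym (∸-+-assoc (b + c) β γ)) (trans (cong (_∸ γ) (+-∸-comm c β≤b)) (+-∸-assoc (b ∸ β) γ≤c))

shift-YZ≤Q : ∀ {F} α β γ ν → β + γ ≤ ν → YZ≤Q F → YZ≤Q (shift (α , β , γ , ν) F)
shift-YZ≤Q {F} α β γ ν β+γ≤ν F-bound a b c n n<b+c =
  guard-≡0 (α ≤ᵇ a) λ _ → guard-≡0 (β ≤ᵇ b) λ β≤b → guard-≡0 (γ ≤ᵇ c) λ γ≤c → guard-≡0 (ν ≤ᵇ n) λ ν≤n →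
    F-bound _ _ _ _ (bound (≤ᵇ⇒≤ β b β≤b) (≤ᵇ⇒≤ γ c γ≤c) (≤ᵇ⇒≤ ν n ν≤n))
  where
  bound : β ≤ b → γ ≤ c → ν ≤ n → n ∸ ν < (b ∸ β) + (c ∸ γ)
  bound β≤b γ≤c ν≤n =
    ≤-<-trans (∸-monoʳ-≤ n β+γ≤ν)
              (<-≤-trans (∸-monoˡ-< n<b+c (≤-trans β+γ≤ν ν≤n)) (≤-reflexive (+-∸-+ β≤b γ≤c)))

timesFactor-YZ≤Q : ∀ {s F} → 1 ≤ s → YZ≤Q F → YZ≤Q (timesFactor s F)
timesFactor-YZ≤Q {s} {F} 1≤s F-bound a b c n n<b+c =
  sum-map-zero {f = λ e → shift e F a b c n} {factorExponents s}
  (F-bound a b c n n<b+c ∷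
   All.map (λ { {α , β , γ , ν} (β+γ≤1 , s≤ν) →
                shift-YZ≤Q α β γ ν (≤-trans β+γ≤1 (≤-trans 1≤s s≤ν)) F-bound a b c n n<b+c })
           (nonUnitExponents-bounds s))

prodUpTo-YZ≤Q : ∀ N → YZ≤Q (prodUpTo N)
prodUpTo-YZ≤Q zero    a (suc b) c       n _  = guard-zero (a ≡ᵇ 0)
prodUpTo-YZ≤Q zero    a zero    (suc c) n _  = guard-zero (a ≡ᵇ 0)
prodUpTo-YZ≤Q (suc N) a b       c       n lt =
  trans (prodUpTo-suc N a b c n) (timesFactor-YZ≤Q (m^n>0 2 N) (prodUpTo-YZ≤Q N) a b c n lt)

substQ²-YZ≤Q : ∀ {F} → YZ≤Q F → YZ≤Q (substQ² F)
substQ²-YZ≤Q {F} F-bound a b c n n<b+c with parity n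
... | even t = trans (subX²-even (F a b c) t) (F-bound a b c t (≤-<-trans (m≤m*n t 2) n<b+c))
... | odd  t = subX²-odd (F a b c) t

shift-below : ∀ {F} α β γ ν {a b c n} → n < ν → shift (α , β , γ , ν) F a b c n ≡ 0
shift-below α β γ ν {a} {b} {c} {n} n<ν =
  guard-≡0 (α ≤ᵇ a) λ _ → guard-≡0 (β ≤ᵇ b) λ _ → guard-≡0 (γ ≤ᵇ c) λ _ → guard-≰ _ n<ν

timesFactor-below : ∀ {s} F a b c n → n < s → timesFactor s F a b c n ≡ F a b c n
timesFactor-below {s} F a b c n n<s =
  trans (cong (F a b c n +_) (sum-map-zero {f = λ e → shift e F a b c n} {nonUnitExponents s}
          (All.map (λ { {α , β , γ , ν} (_ , s≤ν) → shift-below {F} α β γ ν (<-≤-trans n<s s≤ν) })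
                   (nonUnitExponents-bounds s))))
        (+-identityʳ _)

n<2^n : ∀ n → n < 2 ^ n
n<2^n zero    = s≤s z≤n
n<2^n (suc n) = +-mono-≤ (m^n>0 2 n) (≤-trans (n<2^n n) (m≤m+n (2 ^ n) 0))

prodUpTo-stable : ∀ {n N} → n < N → ∀ a b c → prodUpTo N a b c n ≡ p n a b c
prodUpTo-stable {n} n<N a b c = go (≤⇒≤′ n<N)
  where
  go : ∀ {N} → suc n ≤′ N → prodUpTo N a b c n ≡ p n a b c
  go ≤′-refl            = refl
  go (≤′-step {N} n<N) = trans (prodUpTo-suc N a b c n)
    (trans (timesFactor-below (prodUpTo N) a b c n (<-trans (≤′⇒≤ n<N) (n<2^n N))) (go n<N))

-- Specialisation y = z = 1

atYZ1 : Ser → ℕ → Poly₁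
atYZ1 F n a = Σ≤ n λ b → Σ≤ n λ c → F a b c n

atYZ1-cong : ∀ {F G} → F ≐ G → ∀ n a → atYZ1 F n a ≡ atYZ1 G n a
atYZ1-cong F≐G n a = Σ≤-cong n λ b → Σ≤-cong n λ c → F≐G a b c n

atYZ1-truncate : ∀ {F m M} a → YZ≤Q F → m ≤ M → (Σ≤ M λ b → Σ≤ M λ c → F a b c m) ≡ atYZ1 F m a
atYZ1-truncate {F} {m} {M} a F-bound m≤M =
  trans (Σ≤-cong M λ b → Σ≤-truncate _ m≤M λ c m<c → F-bound a b c m (<-≤-trans m<c (m≤n+m c b)))
        (Σ≤-truncate _ m≤M λ b m<b → Σ≤-zero m λ c → F-bound a b c m (<-≤-trans m<b (m≤m+n b c)))

atYZ1-shift : ∀ {F} α β γ ν n a → YZ≤Q F → β + γ ≤ ν →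
  atYZ1 (shift (α , β , γ , ν) F) n a ≡ guard (α ≤ᵇ a) (shiftq ν (λ m → atYZ1 F m (a ∸ α)) n)
atYZ1-shift {F} α β γ ν n a F-bound β+γ≤ν with ν ≤? n
... | no ν≰n = trans (Σ≤-zero n λ b → Σ≤-zero n λ c → shift-below {F} α β γ ν (≰⇒> ν≰n))
                     (sym (trans (cong (guard (α ≤ᵇ a)) (guard-≰ _ (≰⇒> ν≰n))) (guard-zero _)))
... | yes ν≤n = begin
    (Σ≤ n λ b → Σ≤ n λ c → guard A (guard (β ≤ᵇ b) (guard (γ ≤ᵇ c) (guard (ν ≤ᵇ n) (G (b ∸ β) (c ∸ γ))))))
  ≡⟨ (Σ≤-cong n λ b → Σ≤-cong n λ c →
       cong (λ x → guard A (guard (β ≤ᵇ b) (guard (γ ≤ᵇ c) x))) (guard-≤ _ ν≤n)) ⟩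
    (Σ≤ n λ b → Σ≤ n λ c → guard A (guard (β ≤ᵇ b) (guard (γ ≤ᵇ c) (G (b ∸ β) (c ∸ γ)))))
  ≡⟨ trans (Σ≤-cong n λ b → Σ≤-guard n A _) (Σ≤-guard n A _) ⟩
    guard A (Σ≤ n λ b → Σ≤ n λ c → guard (β ≤ᵇ b) (guard (γ ≤ᵇ c) (G (b ∸ β) (c ∸ γ))))
  ≡⟨ cong (guard A) (Σ≤-cong n λ b → trans (Σ≤-guard n (β ≤ᵇ b) _) (cong (guard (β ≤ᵇ b))
       (Σ≤-shift-truncate (G (b ∸ β)) γ≤n (∸-monoʳ-≤ n γ≤ν) λ c n∸ν<c →
          F-bound _ (b ∸ β) c _ (<-≤-trans n∸ν<c (m≤n+m c (b ∸ β)))))) ⟩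
    guard A (Σ≤ n λ b → guard (β ≤ᵇ b) (Σ≤ (n ∸ ν) λ c → G (b ∸ β) c))
  ≡⟨ cong (guard A) (Σ≤-shift-truncate (λ b → Σ≤ (n ∸ ν) (G b)) β≤n (∸-monoʳ-≤ n β≤ν) λ b n∸ν<b →
       Σ≤-zero (n ∸ ν) λ c → F-bound _ b c _ (<-≤-trans n∸ν<b (m≤m+n b c))) ⟩
    guard A (atYZ1 F (n ∸ ν) (a ∸ α))
  ≡⟨ cong (guard A) (guard-≤ _ ν≤n) ⟨
    guard A (shiftq ν (λ m → atYZ1 F m (a ∸ α)) n)
  ∎
  where
  A = α ≤ᵇ a
  G : ℕ → ℕ → ℕ
  G b c = F (a ∸ α) b c (n ∸ ν)
  β≤ν = ≤-trans (m≤m+n β γ) β+γ≤ν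
  γ≤ν = ≤-trans (m≤n+m γ β) β+γ≤ν
  β≤n = ≤-trans β≤ν ν≤n
  γ≤n = ≤-trans γ≤ν ν≤n

atYZ1-timesFactor : ∀ s F n a →
  atYZ1 (timesFactor s F) n a ≡ sum (map (λ e → atYZ1 (shift e F) n a) (factorExponents s))
atYZ1-timesFactor s F n a =
  trans (Σ≤-cong n λ b → Σ≤-sum n (λ c e → shift e F a b c n) (factorExponents s))
        (Σ≤-sum n (λ b e → Σ≤ n λ c → shift e F a b c n) (factorExponents s))

atYZ1-substQ²-even : ∀ {F} t a → YZ≤Q F → atYZ1 (substQ² F) (t * 2) a ≡ atYZ1 F t a
atYZ1-substQ²-even {F} t a F-bound =
  trans (Σ≤-cong (t * 2) λ b → Σ≤-cong (t * 2) λ c → subX²-even (F a b c) t)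
        (atYZ1-truncate a F-bound (m≤m*n t 2))

atYZ1-substQ²-odd : ∀ F t a → atYZ1 (substQ² F) (suc (t * 2)) a ≡ 0
atYZ1-substQ²-odd F t a = Σ≤-zero (suc (t * 2)) λ b → Σ≤-zero (suc (t * 2)) λ c → subX²-odd (F a b c) t

-- Recurrences for p_n(x,1,1)

sq₁₁ : ℕ → ℕ → Poly₁
sq₁₁ N = atYZ1 (substQ² (prodUpTo N))

expansionTerm : ℕ → ℕ → Exponent → ℕ
expansionTerm n a (α , _ , _ , ν) = guard (α ≤ᵇ a) (shiftq ν (λ m → sq₁₁ n m (a ∸ α)) n)

p₁₁-expand : ∀ n a → p₁₁ n a ≡ sum (map (expansionTerm n a) (factorExponents 1))
p₁₁-expand n a = begin
  atYZ1 (prodUpTo (suc n)) n a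
    ≡⟨ atYZ1-cong (prodUpTo-functional n) n a ⟩
  atYZ1 (timesFactor 1 G) n a
    ≡⟨ atYZ1-timesFactor 1 G n a ⟩
  sum (map (λ e → atYZ1 (shift e G) n a) (factorExponents 1))
    ≡⟨ sum-map-congᴬ {f = λ e → atYZ1 (shift e G) n a} {g = expansionTerm n a} {factorExponents 1}
         (atYZ1-shift {G} 0 0 0 0 n a G-bound z≤n ∷
          All.map (λ { {α , β , γ , ν} (β+γ≤1 , 1≤ν) →
                       atYZ1-shift {G} α β γ ν n a G-bound (≤-trans β+γ≤1 1≤ν) })
                  (nonUnitExponents-bounds 1)) ⟩
  sum (map (expansionTerm n a) (factorExponents 1))
  ∎
  where
  G = substQ² (prodUpTo n)
  G-bound = substQ²-YZ≤Q (prodUpTo-YZ≤Q n)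

module _ (N : ℕ) where

  sq₁₁-even : ∀ {t} → t < N → ∀ a → sq₁₁ N (t * 2) a ≡ p₁₁ t a
  sq₁₁-even {t} t<N a = trans (atYZ1-substQ²-even t a (prodUpTo-YZ≤Q N))
                           (Σ≤-cong t λ b → Σ≤-cong t λ c → prodUpTo-stable t<N a b c)

  sq₁₁-odd : ∀ t a → sq₁₁ N (suc (t * 2)) a ≡ 0
  sq₁₁-odd = atYZ1-substQ²-odd (prodUpTo N)

  x·sq₁₁-even : ∀ {t} → t < N → ∀ a → guard (1 ≤ᵇ a) (sq₁₁ N (t * 2) (a ∸ 1)) ≡ mulX (p₁₁ t) a
  x·sq₁₁-even t<N zero    = refl
  x·sq₁₁-even t<N (suc a) = sq₁₁-even t<N a

  x·sq₁₁-odd : ∀ t a → guard (1 ≤ᵇ a) (sq₁₁ N (suc (t * 2)) (a ∸ 1)) ≡ 0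
  x·sq₁₁-odd t a = trans (cong (guard (1 ≤ᵇ a)) (sq₁₁-odd t (a ∸ 1))) (guard-zero _)

p₁₁⁻ : ℕ → Poly₁
p₁₁⁻ zero    _ = 0
p₁₁⁻ (suc k)   = p₁₁ k

mulX-zero : ∀ a → mulX (λ _ → 0) a ≡ 0
mulX-zero zero    = refl
mulX-zero (suc a) = refl

half< : ∀ t k → t < suc (k + t * 2)
half< t k = s≤s (≤-trans (m≤m*n t 2) (m≤n+m (t * 2) k))

p₁₁-odd : ∀ k a → p₁₁ (suc (k * 2)) a ≡ p₁₁ k a + (mulX (p₁₁ k) a + mulX (p₁₁⁻ k) a)
p₁₁-odd zero a = begin
  p₁₁ 1 a
    ≡⟨ p₁₁-expand 1 a ⟩
  sum (map (expansionTerm 1 a) (factorExponents 1))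
    ≡⟨ cong sum (Pointwise-≡⇒≡ (sq₁₁-odd 1 0 a ∷ sq₁₁-even 1 (half< 0 0) a ∷ refl {x = 0} ∷
                                 x·sq₁₁-even 1 (half< 0 0) a ∷ guard-zero (1 ≤ᵇ a) ∷ guard-zero (1 ≤ᵇ a) ∷ [])) ⟩
  sum (0 ∷ p₁₁ 0 a ∷ 0 ∷ mulX (p₁₁ 0) a ∷ 0 ∷ 0 ∷ [])
    ≡⟨ cong (λ z → p₁₁ 0 a + (mulX (p₁₁ 0) a + z)) (mulX-zero a) ⟨
  p₁₁ 0 a + (mulX (p₁₁ 0) a + mulX (p₁₁⁻ 0) a)
  ∎
p₁₁-odd (suc m) a = begin
  p₁₁ n a
    ≡⟨ p₁₁-expand n a ⟩
  sum (map (expansionTerm n a) (factorExponents 1))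
    ≡⟨ cong sum (Pointwise-≡⇒≡ (sq₁₁-odd n (suc m) a ∷ sq₁₁-even n (half< (suc m) 0) a ∷ sq₁₁-odd n m a ∷
                                 x·sq₁₁-even n (half< (suc m) 0) a ∷ x·sq₁₁-odd n m a ∷
                                 x·sq₁₁-even n (half< m 2) a ∷ [])) ⟩
  sum (0 ∷ p₁₁ (suc m) a ∷ 0 ∷ mulX (p₁₁ (suc m)) a ∷ 0 ∷ mulX (p₁₁ m) a ∷ [])
    ≡⟨ cong (λ z → p₁₁ (suc m) a + (mulX (p₁₁ (suc m)) a + z)) (+-identityʳ _) ⟩
  p₁₁ (suc m) a + (mulX (p₁₁ (suc m)) a + mulX (p₁₁ m) a)
  ∎
  where n = suc (suc m * 2)

p₁₁⁻-odd : ∀ k a → p₁₁⁻ (suc (k * 2)) a ≡ p₁₁ k a + (p₁₁⁻ k a + mulX (p₁₁⁻ k) a)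
p₁₁⁻-odd zero    a = sym (trans (cong (p₁₁ 0 a +_) (mulX-zero a)) (+-identityʳ _))
p₁₁⁻-odd (suc m) a = begin
  p₁₁ n a
    ≡⟨ p₁₁-expand n a ⟩
  sum (map (expansionTerm n a) (factorExponents 1))
    ≡⟨ cong sum (Pointwise-≡⇒≡ (sq₁₁-even n (s≤s (half< m 0)) a ∷ sq₁₁-odd n m a ∷
                                 sq₁₁-even n (half< m 1) a ∷ x·sq₁₁-odd n m a ∷
                                 x·sq₁₁-even n (half< m 1) a ∷ x³·sq₁₁ m ∷ [])) ⟩
  sum (p₁₁ (suc m) a ∷ 0 ∷ p₁₁ m a ∷ 0 ∷ mulX (p₁₁ m) a ∷ 0 ∷ [])
    ≡⟨ cong (λ z → p₁₁ (suc m) a + (p₁₁ m a + z)) (+-identityʳ _) ⟩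
  p₁₁ (suc m) a + (p₁₁ m a + mulX (p₁₁ m) a)
  ∎
  where
  n = suc m * 2
  x³·sq₁₁ : ∀ j → expansionTerm (suc j * 2) a (1 , 0 , 1 , 3) ≡ 0
  x³·sq₁₁ zero    = guard-zero (1 ≤ᵇ a)
  x³·sq₁₁ (suc j) = x·sq₁₁-odd (suc (suc j) * 2) j a

-- Interleaving even and odd coefficients

interleave : Poly₁ → Poly₁ → Poly₁
interleave A B = mulX (subX² B) +₁ subX² A

interleave-even : ∀ A B t → interleave A B (t * 2) ≡ A t
interleave-even A B zero    = refl
interleave-even A B (suc t) = cong₂ _+_ (subX²-odd B t) (subX²-even A (suc t))

interleave-odd : ∀ A B t → interleave A B (suc (t * 2)) ≡ B t
interleave-odd A B t = trans (cong₂ _+_ (subX²-even B t) (subX²-odd A t)) (+-identityʳ _)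

mulX-interleave-even : ∀ A B t → mulX (interleave A B) (t * 2) ≡ mulX B t
mulX-interleave-even A B zero    = refl
mulX-interleave-even A B (suc t) = interleave-odd A B t

trinom-*₁ : ∀ G k → (trinom *₁ G) k ≡ G k + (mulX G k + mulX (mulX G) k)
trinom-*₁ G zero          = refl
trinom-*₁ G (suc zero)    = cong (_+ (G 0 + 0)) (+-identityʳ (G 1))
trinom-*₁ G (suc (suc k)) = begin
  Σ≤ (suc (suc k)) h                             ≡⟨ Σ≤-head (suc k) h ⟩
  h 0 + Σ≤ (suc k) (h ∘ suc)                     ≡⟨ cong (h 0 +_) (Σ≤-head k (h ∘ suc)) ⟩
  h 0 + (h 1 + Σ≤ k (h ∘ suc ∘ suc))             ≡⟨ cong (λ z → h 0 + (h 1 + z)) (Σ≤-head-only k) ⟩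
  h 0 + (h 1 + h 2)                              ≡⟨ cong₂ _+_ (+-identityʳ (G (suc (suc k))))
                                                      (cong₂ _+_ (+-identityʳ (G (suc k))) (+-identityʳ (G k))) ⟩
  G (suc (suc k)) + (G (suc k) + G k)            ∎
  where
  h : ℕ → ℕ
  h i = trinom i * G (suc (suc k) ∸ i)
  Σ≤-head-only : ∀ j → Σ≤ j (h ∘ suc ∘ suc) ≡ h 2
  Σ≤-head-only zero    = refl
  Σ≤-head-only (suc j) = trans (cong (_+ 0) (Σ≤-head-only j)) (+-identityʳ _)

*₁-congʳ : ∀ F {G H} → (∀ k → G k ≡ H k) → ∀ k → (F *₁ G) k ≡ (F *₁ H) k
*₁-congʳ F G≡H k = Σ≤-cong k λ i → cong (F i *_) (G≡H (k ∸ i))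

interleave-step : ∀ {A B A′ B′ : Poly₁} →
  (∀ a → A′ a ≡ A a + (mulX A a + mulX B a)) → (∀ a → B′ a ≡ A a + (B a + mulX B a)) →
  ∀ k → interleave A′ B′ k ≡ (trinom *₁ interleave A B) k
interleave-step {A} {B} {A′} {B′} A′≡ B′≡ k with parity k
... | even zero    = trans (A′≡ 0) (sym (trinom-*₁ (interleave A B) 0))
... | even (suc t) = begin
  interleave A′ B′ (suc t * 2)                     ≡⟨ interleave-even A′ B′ (suc t) ⟩
  A′ (suc t)                                       ≡⟨ A′≡ (suc t) ⟩
  A (suc t) + (A t + B t)                          ≡⟨ cong (A (suc t) +_) (+-comm (A t) (B t)) ⟩
  A (suc t) + (B t + A t)                          ≡⟨ cong₂ _+_ (interleave-even A B (suc t))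
                                                       (cong₂ _+_ (interleave-odd A B t) (interleave-even A B t)) ⟨
  I (suc t * 2) + (I (suc (t * 2)) + I (t * 2))    ≡⟨ trinom-*₁ I (suc t * 2) ⟨
  (trinom *₁ I) (suc t * 2)                        ∎
  where I = interleave A B
... | odd t        = begin
  interleave A′ B′ (suc (t * 2))                   ≡⟨ interleave-odd A′ B′ t ⟩
  B′ t                                             ≡⟨ B′≡ t ⟩
  A t + (B t + mulX B t)                           ≡⟨ x∙yz≈y∙xz (A t) (B t) _ ⟩
  B t + (A t + mulX B t)                           ≡⟨ cong₂ _+_ (interleave-odd A B t)
                                                       (cong₂ _+_ (interleave-even A B t) (mulX-interleave-even A B t)) ⟨
  I (suc (t * 2)) + (I (t * 2) + mulX I (t * 2))   ≡⟨ trinom-*₁ I (suc (t * 2)) ⟨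
  (trinom *₁ I) (suc (t * 2))                      ∎
  where I = interleave A B

p₁₁-zero : ∀ a → p₁₁ 0 a ≡ one₁ a
p₁₁-zero a =
  trans (prodUpTo-suc 0 a 0 0 0) (trans (timesFactor-below {1} oneₛ a 0 0 0 (s≤s z≤n)) (oneₛ≡one₁ a))
  where
  oneₛ≡one₁ : ∀ a → oneₛ a 0 0 0 ≡ one₁ a
  oneₛ≡one₁ zero    = refl
  oneₛ≡one₁ (suc a) = refl

interleave-base : ∀ k → interleave (p₁₁ 0) (p₁₁⁻ 0) k ≡ one₁ k
interleave-base k with parity k
... | even zero    = refl
... | even (suc t) = trans (interleave-even (p₁₁ 0) (p₁₁⁻ 0) (suc t)) (p₁₁-zero (suc t))
... | odd t        = interleave-odd (p₁₁ 0) (p₁₁⁻ 0) t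

2^≡1+[2^∸1] : ∀ n → 2 ^ n ≡ suc (2 ^ n ∸ 1)
2^≡1+[2^∸1] n = sym (m+[n∸m]≡n (m^n>0 2 n))

2^suc∸1 : ∀ n → 2 ^ suc n ∸ 1 ≡ suc ((2 ^ n ∸ 1) * 2)
2^suc∸1 n = trans (cong (λ m → 2 * m ∸ 1) (2^≡1+[2^∸1] n)) (cong (_∸ 1) (*-comm 2 (suc (2 ^ n ∸ 1))))

2^suc∸2 : ∀ n → 2 ^ suc n ∸ 2 ≡ (2 ^ n ∸ 1) * 2
2^suc∸2 n = trans (sym (∸-+-assoc (2 ^ suc n) 1 1)) (cong (_∸ 1) (2^suc∸1 n))

interleave-trinom^ : ∀ n k → interleave (p₁₁ (2 ^ n ∸ 1)) (p₁₁⁻ (2 ^ n ∸ 1)) k ≡ (trinom ^₁ n) k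
interleave-trinom^ zero    k = interleave-base k
interleave-trinom^ (suc n) k rewrite 2^suc∸1 n = begin
  interleave (p₁₁ (suc (K * 2))) (p₁₁⁻ (suc (K * 2))) k
    ≡⟨ interleave-step {p₁₁ K} {p₁₁⁻ K} (p₁₁-odd K) (p₁₁⁻-odd K) k ⟩
  (trinom *₁ interleave (p₁₁ K) (p₁₁⁻ K)) k
    ≡⟨ *₁-congʳ trinom (interleave-trinom^ n) k ⟩
  (trinom *₁ (trinom ^₁ n)) k
  ∎
  where K = 2 ^ n ∸ 1

Q≡p₁₁⁻ : ∀ n → Q n ≡ p₁₁⁻ (2 ^ suc n ∸ 1)
Q≡p₁₁⁻ n = trans (cong p₁₁ (2^suc∸2 n)) (cong p₁₁⁻ (sym (2^suc∸1 n)))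

proposition4p3 : (n : ℕ) → 1 ≤ n → (k : ℕ) → (mulX (subX² (Q (n ∸ 1))) +₁ subX² (R n)) k ≡ (trinom ^₁ n) k
proposition4p3 (suc n) _ k =
  subst (λ B → interleave (R (suc n)) B k ≡ (trinom ^₁ suc n) k) (sym (Q≡p₁₁⁻ n))
        (interleave-trinom^ (suc n) k)
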